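{- Let $G$ be a nontrivial uniquely $C_4^{+}$-saturated graph. Then $G$ is connected and has diameter $2$.
   Context: All graphs are finite, simple and undirected. $C_4^{+}$ (the diamond) is the graph obtained from a $4$-cycle by adding one chord, i.e. $K_4$ minus an edge. For a graph $H$, a graph $G$ is uniquely $H$-saturated if $G$ contains no subgraph isomorphic to $H$, but for every pair of non-adjacent vertices $u,v$ of $G$, the graph $G+uv$ contains exactly one subgraph isomorphic to $H$. A uniquely $H$-saturated graph is nontrivial if it has at least $|V(H)|$ vertices (so here at least $4$ vertices). -}

module Defs where

open import Data.Nat using (ℕ; zero; suc; _≤_)
open import Data.Fin using (Fin)
open import Data.Product using (Σ; ∃; ∃-syntax; _×_; _,_)
open import Data.Sum using (_⊎_)
open import Relation.Nullary using (¬_; Dec)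
open import Relation.Binary.PropositionalEquality using (_≡_; _≢_)
open import Function.Bundles using (_⇔_)

record Graph (n : ℕ) : Set₁ where
  field
    Adj    : Fin n → Fin n → Set
    sym    : ∀ {x y} → Adj x y → Adj y x
    irrefl : ∀ {x} → ¬ Adj x x
    dec    : ∀ x y → Dec (Adj x y)
open Graph public

SamePair : ∀ {n} → Fin n → Fin n → Fin n → Fin n → Set
SamePair x y u v = (x ≡ u × y ≡ v) ⊎ (x ≡ v × y ≡ u)

AddEdge : ∀ {n} → (Fin n → Fin n → Set) → Fin n → Fin n → Fin n → Fin n → Set
AddEdge A u v x y = A x y ⊎ SamePair x y u v

-- A copy of the diamond C4+ (K4 minus an edge) in a graph with adjacency A:
-- four distinct vertices a b c d; the chord (spine) is cd, and
-- the edges are cd, ac, ad, bc, bd (ab is the missing edge of K4,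
-- it may or may not be present in the host graph).
record Diamond {n : ℕ} (A : Fin n → Fin n → Set) : Set where
  constructor diamond
  field
    a b c d : Fin n
    a≢b : a ≢ b
    a≢c : a ≢ c
    a≢d : a ≢ d
    b≢c : b ≢ c
    b≢d : b ≢ d
    c≢d : c ≢ d
    cd : A c d
    ac : A a c
    ad : A a d
    bc : A b c
    bd : A b d
open Diamond public

DEdge : ∀ {n} {A : Fin n → Fin n → Set} → Diamond A → Fin n → Fin n → Set
DEdge D x y =
  SamePair x y (c D) (d D) ⊎ SamePair x y (a D) (c D) ⊎ SamePair x y (a D) (d D)
  ⊎ SamePair x y (b D) (c D) ⊎ SamePair x y (b D) (d D)

SameSubgraph : ∀ {n} {A : Fin n → Fin n → Set} → Diamond A → Diamond A → Set
SameSubgraph D E = ∀ x y → (DEdge D x y ⇔ DEdge E x y)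

ExactlyOneDiamond : ∀ {n} → (Fin n → Fin n → Set) → Set
ExactlyOneDiamond A = Σ (Diamond A) λ D → ∀ (E : Diamond A) → SameSubgraph D E

UniquelyDiamondSaturated : ∀ {n} → Graph n → Set
UniquelyDiamondSaturated G =
  ¬ Diamond (Adj G) ×
  (∀ u v → u ≢ v → ¬ Adj G u v → ExactlyOneDiamond (AddEdge (Adj G) u v))

data Walk {n : ℕ} (G : Graph n) : ℕ → Fin n → Fin n → Set where
  [] : ∀ {x} → Walk G zero x x
  _∷_ : ∀ {k x y z} → Adj G x y → Walk G k y z → Walk G (suc k) x z

Connected : ∀ {n} → Graph n → Set
Connected G = ∀ x y → ∃[ k ] Walk G k x y

DistLe : ∀ {n} → Graph n → ℕ → Fin n → Fin n → Set
DistLe G k x y = ∃[ j ] (j ≤ k × Walk G j x y)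

Diameter2 : ∀ {n} → Graph n → Set
Diameter2 G = (∀ x y → DistLe G 2 x y) × (∃[ x ] ∃[ y ] ¬ DistLe G 1 x y)

{-# OPTIONS --safe #-}
-- Adding a non-edge uv to a diamond-free graph creates a diamond only if the
-- diamond uses uv, and every edge of a diamond lies in one of its two
-- triangles; the apex of that triangle is a common neighbour of u and v.
-- So any two vertices are at distance at most 2. The diameter is not 1, since a complete graph on
-- at least four vertices contains a diamond.
module Submission where

open import Defs
open import Data.Nat using (ℕ; _≤_; zero; suc; s≤s; z≤n)
open import Data.Nat.Properties using (≤-refl)
open import Data.Fin using (_≟_; #_)
open import Data.Product using (_×_; _,_; proj₁; ∃-syntax)
open import Data.Sum using (inj₁; inj₂)
open import Data.Empty using (⊥-elim)
open import Relation.Nullary using (¬_; yes; no)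
open import Relation.Binary.PropositionalEquality using (_≢_; refl; ≢-sym)

DiamondSaturated : ∀ {n} → Graph n → Set
DiamondSaturated G =
  ¬ Diamond (Adj G) × (∀ u v → u ≢ v → ¬ Adj G u v → Diamond (AddEdge (Adj G) u v))

uniquelySaturated⇒saturated : ∀ {n} {G : Graph n} →
  UniquelyDiamondSaturated G → DiamondSaturated G
uniquelySaturated⇒saturated (diamond-free , unique) =
  diamond-free , λ u v u≢v ¬uv → proj₁ (unique u v u≢v ¬uv)

module _ {n : ℕ} (G : Graph n) where

  AddEdge-sym : ∀ {u v x y} → AddEdge (Adj G) u v x y → AddEdge (Adj G) u v y x
  AddEdge-sym (inj₁ xy)                   = inj₁ (Graph.sym G xy)
  AddEdge-sym (inj₂ (inj₁ (refl , refl))) = inj₂ (inj₂ (refl , refl))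
  AddEdge-sym (inj₂ (inj₂ (refl , refl))) = inj₂ (inj₁ (refl , refl))

  AddEdge-old : ∀ {u v x y} → x ≢ u → x ≢ v → AddEdge (Adj G) u v x y → Adj G x y
  AddEdge-old x≢u x≢v (inj₁ xy)               = xy
  AddEdge-old x≢u x≢v (inj₂ (inj₁ (x≡u , _))) = ⊥-elim (x≢u x≡u)
  AddEdge-old x≢u x≢v (inj₂ (inj₂ (x≡v , _))) = ⊥-elim (x≢v x≡v)

  apex-walk : ∀ {u v p q w} → SamePair p q u v → w ≢ p → w ≢ q →
    AddEdge (Adj G) u v w p → AddEdge (Adj G) u v w q → Walk G 2 u v
  apex-walk (inj₁ (refl , refl)) w≢u w≢v wu wv =
    Graph.sym G (AddEdge-old w≢u w≢v wu) ∷ (AddEdge-old w≢u w≢v wv ∷ [])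
  apex-walk (inj₂ (refl , refl)) w≢v w≢u wv wu =
    Graph.sym G (AddEdge-old w≢u w≢v wu) ∷ (AddEdge-old w≢u w≢v wv ∷ [])

  common-neighbour : ∀ {u v} → ¬ Diamond (Adj G) → Diamond (AddEdge (Adj G) u v) →
    Walk G 2 u v
  common-neighbour diamond-free (diamond a b c d a≢b a≢c a≢d b≢c b≢d c≢d cd ac ad bc bd)
    with cd | ac | ad | bc | bd
  ... | inj₂ new | _ | _ | _ | _ = apex-walk new a≢c a≢d ac ad
  ... | _ | inj₂ new | _ | _ | _ =
    apex-walk new (≢-sym a≢d) (≢-sym c≢d) (AddEdge-sym ad) (AddEdge-sym cd)
  ... | _ | _ | inj₂ new | _ | _ = apex-walk new (≢-sym a≢c) c≢d (AddEdge-sym ac) cd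
  ... | _ | _ | _ | inj₂ new | _ =
    apex-walk new (≢-sym b≢d) (≢-sym c≢d) (AddEdge-sym bd) (AddEdge-sym cd)
  ... | _ | _ | _ | _ | inj₂ new = apex-walk new (≢-sym b≢c) c≢d (AddEdge-sym bc) cd
  ... | inj₁ cd′ | inj₁ ac′ | inj₁ ad′ | inj₁ bc′ | inj₁ bd′ =
    ⊥-elim (diamond-free (diamond a b c d a≢b a≢c a≢d b≢c b≢d c≢d cd′ ac′ ad′ bc′ bd′))

  saturated⇒distLe2 : DiamondSaturated G → ∀ x y → DistLe G 2 x y
  saturated⇒distLe2 (diamond-free , saturated) x y with x ≟ y | dec G x y
  ... | yes refl | _     = 0 , z≤n , []
  ... | no _     | yes xy = 1 , s≤s z≤n , xy ∷ []
  ... | no x≢y   | no ¬xy =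
    2 , ≤-refl , common-neighbour diamond-free (saturated x y x≢y ¬xy)

  distLe⇒connected : ∀ {k} → (∀ x y → DistLe G k x y) → Connected G
  distLe⇒connected bounded x y with bounded x y
  ... | j , _ , walk = j , walk

  nonadjacent⇒¬distLe1 : ∀ {x y} → x ≢ y → ¬ Adj G x y → ¬ DistLe G 1 x y
  nonadjacent⇒¬distLe1 x≢y ¬xy (zero , _ , [])          = x≢y refl
  nonadjacent⇒¬distLe1 x≢y ¬xy (suc zero , _ , xy ∷ [])  = ¬xy xy
  nonadjacent⇒¬distLe1 x≢y ¬xy (suc (suc _) , s≤s () , _)

diamond-free⇒nonadjacent : ∀ {n} (G : Graph n) → 4 ≤ n → ¬ Diamond (Adj G) →
  ∃[ x ] ∃[ y ] (x ≢ y × ¬ Adj G x y)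
diamond-free⇒nonadjacent G (s≤s (s≤s (s≤s (s≤s _)))) diamond-free
  with dec G (# 2) (# 3) | dec G (# 0) (# 2) | dec G (# 0) (# 3) | dec G (# 1) (# 2) | dec G (# 1) (# 3)
... | no ¬23 | _ | _ | _ | _ = # 2 , # 3 , (λ ()) , ¬23
... | _ | no ¬02 | _ | _ | _ = # 0 , # 2 , (λ ()) , ¬02
... | _ | _ | no ¬03 | _ | _ = # 0 , # 3 , (λ ()) , ¬03
... | _ | _ | _ | no ¬12 | _ = # 1 , # 2 , (λ ()) , ¬12
... | _ | _ | _ | _ | no ¬13 = # 1 , # 3 , (λ ()) , ¬13
... | yes e₂₃ | yes e₀₂ | yes e₀₃ | yes e₁₂ | yes e₁₃ = ⊥-elim (diamond-free
  (diamond (# 0) (# 1) (# 2) (# 3) (λ ()) (λ ()) (λ ()) (λ ()) (λ ()) (λ ()) e₂₃ e₀₂ e₀₃ e₁₂ e₁₃))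

lemma2p1 : (n : ℕ) (G : Graph n) → 4 ≤ n → UniquelyDiamondSaturated G → Connected G × Diameter2 G
lemma2p1 n G 4≤n unique with uniquelySaturated⇒saturated {G = G} unique
... | saturated@(diamond-free , _) with diamond-free⇒nonadjacent G 4≤n diamond-free
...   | x , y , x≢y , ¬xy =
  distLe⇒connected G distLe2 , distLe2 , x , y , nonadjacent⇒¬distLe1 G x≢y ¬xy
  where
  distLe2 : ∀ u v → DistLe G 2 u v
  distLe2 = saturated⇒distLe2 G saturated
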